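{- Let $G$ be a finite connected nearly transitive graph with diameter $d\ge 20$. Then $G$ contains an induced cycle of length at least $d-17$.
   Context: Graphs are finite, simple and undirected. The diameter of $G$ is the maximum distance between two of its vertices. $G$ is nearly transitive if for any two vertices $u,v\in V(G)$ there is an automorphism of $G$ mapping $v$ either to $u$ or to a neighbor of $u$. -}

module Defs where

open import Data.Nat using (ℕ; zero; suc; _≤_; _<_; _∸_; _+_)
open import Data.Fin using (Fin; toℕ)
open import Data.Bool using (Bool; true; false)
open import Data.Product using (Σ; ∃; _×_; _,_)
open import Data.Sum using (_⊎_)
open import Relation.Binary.PropositionalEquality using (_≡_)
open import Relation.Nullary using (¬_)
open import Function.Bundles using (_↔_; Inverse)
open import Function.Definitions using (Injective)

record Graph : Set where
  field
    n     : ℕ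
    adj   : Fin n → Fin n → Bool
    sym   : ∀ x y → adj x y ≡ adj y x
    irrefl : ∀ x → adj x x ≡ false

open Graph public

Vertex : Graph → Set
Vertex G = Fin (n G)

Adj : (G : Graph) → Vertex G → Vertex G → Set
Adj G x y = adj G x y ≡ true

data Walk (G : Graph) : Vertex G → Vertex G → ℕ → Set where
  here : ∀ {u} → Walk G u u zero
  step : ∀ {u w v k} → Adj G u w → Walk G w v k → Walk G u v (suc k)

DistLe : (G : Graph) → Vertex G → Vertex G → ℕ → Set
DistLe G u v k = Σ ℕ λ m → m ≤ k × Walk G u v m

Connected : Graph → Set
Connected G = ∀ u v → Σ ℕ λ k → Walk G u v k

IsDiameter : Graph → ℕ → Set
IsDiameter G d =
  (∀ u v → DistLe G u v d) ×
  (Σ (Vertex G) λ u → Σ (Vertex G) λ v → ∀ m → m < d → ¬ Walk G u v m)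

record Automorphism (G : Graph) : Set where
  field
    perm     : Vertex G ↔ Vertex G
    preserve : ∀ x y → adj G (Inverse.to perm x) (Inverse.to perm y) ≡ adj G x y

NearlyTransitive : Graph → Set
NearlyTransitive G =
  ∀ u v → Σ (Automorphism G) λ σ →
    let σv = Inverse.to (Automorphism.perm σ) v in
    (σv ≡ u) ⊎ Adj G u σv

CycleSucc : (k : ℕ) → Fin k → Fin k → Set
CycleSucc k i j = (toℕ j ≡ suc (toℕ i)) ⊎ ((suc (toℕ i) ≡ k) × (toℕ j ≡ 0))

CycleAdj : (k : ℕ) → Fin k → Fin k → Set
CycleAdj k i j = CycleSucc k i j ⊎ CycleSucc k j i

record InducedCycle (G : Graph) (k : ℕ) : Set where
  field
    three≤k : 3 ≤ k
    c       : Fin k → Vertex G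
    inj     : Injective _≡_ _≡_ c
    adjIff  : ∀ i j → (Adj G (c i) (c j) → CycleAdj k i j) × (CycleAdj k i j → Adj G (c i) (c j))

{-# OPTIONS --safe #-}
module Submission where

open import Defs hiding (sym)
open import Data.Nat using (ℕ; zero; suc; _+_; _*_; _∸_; _≤_; _<_; z≤n; s≤s; _<?_; _≤?_)
open import Data.Nat.Properties
open import Data.Nat.Induction using (<-wellFounded)
open import Data.Nat.DivMod using (_/_; _%_; m≡m%n+[m/n]*n; m%n<n; m≥n⇒m/n>0)
open import Data.Nat.Tactic.RingSolver using (solve-∀)
open import Data.Bool using (true)
import Data.Bool.Properties as Bool
open import Data.Fin using (Fin; toℕ)
import Data.Fin.Properties as Fin
open import Data.Product using (Σ; _×_; _,_; proj₁; proj₂)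
open import Data.Sum using (_⊎_; inj₁; inj₂)
open import Function using (_∘_)
open import Function.Bundles using (Inverse)
open import Induction.WellFounded using (Acc; acc)
open import Relation.Binary using (tri<; tri≈; tri>)
open import Relation.Binary.PropositionalEquality
open import Relation.Nullary using (¬_; Dec; yes; no; contradiction)
open import Relation.Nullary.Decidable using (_×-dec_; _⊎-dec_)

-- Take a geodesic P of length d from u to v, pick r with 4r + 4 ≤ d ≤ 4r + 7, and let a, m, b be
-- the vertices of P at distances 2 + r, 2 + 2r, 2 + 3r from u. Near transitivity gives an
-- automorphism σ moving v into the closed neighbourhood of m, so w₀ = σ u is at distance at least
-- d - 1 from m, while u and v are at distance at least 2r + 2 from m. A vertex within distance r
-- of m on a walk of length at most d from w₀ to u (or from v to w₀) would make that walk longer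
-- than d, so the walk b →P v → w₀ → u →P a meets the r-ball around m only in a and b. That
-- ball contains the closed neighbourhood of the interior of P[a,b]. Shortening the walk to an
-- induced path S and closing it with the geodesic P[a,b] gives an induced cycle of length
-- 2r + |S| ≥ 4r ≥ d - 7.

module _ {G : Graph} where

  private
    V : Set
    V = Vertex G

  adj-sym : ∀ {x y : V} → Adj G x y → Adj G y x
  adj-sym {x} {y} xy = trans (Graph.sym G y x) xy

  adj-irrefl : ∀ {x : V} → ¬ Adj G x x
  adj-irrefl {x} xx with trans (sym xx) (irrefl G x)
  ... | ()

  adj? : ∀ (x y : V) → Dec (Adj G x y)
  adj? x y = adj G x y Bool.≟ true

  -- For t ≥ k this is the last vertex y.
  at : ∀ {x y : V} {k} → Walk G x y k → ℕ → V
  at {x} here       _       = x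
  at {x} (step _ _) zero    = x
  at     (step _ w) (suc t) = at w t

  at-start : ∀ {x y : V} {k} (w : Walk G x y k) → at w 0 ≡ x
  at-start here       = refl
  at-start (step _ _) = refl

  at-end : ∀ {x y : V} {k} (w : Walk G x y k) → at w k ≡ y
  at-end here       = refl
  at-end (step _ w) = at-end w

  at-adj : ∀ {x y : V} {k} (w : Walk G x y k) {t} → t < k → Adj G (at w t) (at w (suc t))
  at-adj (step xz w) {zero}  _         = subst (Adj G _) (sym (at-start w)) xz
  at-adj (step _ w)  {suc t} (s≤s t<k) = at-adj w t<k

  infixr 5 _++_

  _++_ : ∀ {x y z : V} {k l} → Walk G x y k → Walk G y z l → Walk G x z (k + l)
  here      ++ w′ = w′
  step xz w ++ w′ = step xz (w ++ w′)

  at-++ˡ : ∀ {x y z : V} {k l} (w : Walk G x y k) (w′ : Walk G y z l) {t} → t ≤ k →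
           at (w ++ w′) t ≡ at w t
  at-++ˡ here       w′ z≤n       = at-start w′
  at-++ˡ (step _ w) w′ {zero} _  = refl
  at-++ˡ (step _ w) w′ (s≤s t≤k) = at-++ˡ w w′ t≤k

  at-++ʳ : ∀ {x y z : V} {k l} (w : Walk G x y k) (w′ : Walk G y z l) t →
           at (w ++ w′) (k + t) ≡ at w′ t
  at-++ʳ here       w′ t = refl
  at-++ʳ (step _ w) w′ t = at-++ʳ w w′ t

  take : ∀ {x y : V} {k} (w : Walk G x y k) t → t ≤ k → Walk G x (at w t) t
  take here        zero    _         = here
  take (step _ _)  zero    _         = here
  take (step xz w) (suc t) (s≤s t≤k) = step xz (take w t t≤k)

  at-take : ∀ {x y : V} {k} (w : Walk G x y k) {t} (t≤k : t ≤ k) {s} → s ≤ t →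
            at (take w t t≤k) s ≡ at w s
  at-take here       z≤n       z≤n       = refl
  at-take (step _ _) {zero}  _ z≤n       = refl
  at-take (step _ _) (s≤s _) {zero} _    = refl
  at-take (step _ w) (s≤s t≤k) (s≤s s≤t) = at-take w t≤k s≤t

  drop : ∀ {x y : V} {k} (w : Walk G x y k) t → t ≤ k → Walk G (at w t) y (k ∸ t)
  drop here       zero    _         = here
  drop (step xz w) zero   _         = step xz w
  drop (step _ w) (suc t) (s≤s t≤k) = drop w t t≤k

  at-drop : ∀ {x y : V} {k} (w : Walk G x y k) {t} (t≤k : t ≤ k) s →
            at (drop w t t≤k) s ≡ at w (t + s)
  at-drop here       z≤n       s = refl
  at-drop (step _ _) {zero} _  s = refl
  at-drop (step _ w) (s≤s t≤k) s = at-drop w t≤k s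

  slice : ∀ {x y : V} {k} (w : Walk G x y k) i l → i + l ≤ k → Walk G (at w i) (at w (i + l)) l
  slice here        zero    zero _         = here
  slice (step xz w) zero    l    l≤k       = take (step xz w) l l≤k
  slice (step _ w)  (suc i) l    (s≤s i+l≤k) = slice w i l i+l≤k

  at-slice : ∀ {x y : V} {k} (w : Walk G x y k) i {l} (i+l≤k : i + l ≤ k) {t} → t ≤ l →
             at (slice w i l i+l≤k) t ≡ at w (i + t)
  at-slice here        zero    z≤n         z≤n = refl
  at-slice (step xz w) zero    l≤k         t≤l = at-take (step xz w) l≤k t≤l
  at-slice (step _ w)  (suc i) (s≤s i+l≤k) t≤l = at-slice w i i+l≤k t≤l

  infixl 5 _▷_

  _▷_ : ∀ {x y z : V} {k} → Walk G x y k → Adj G y z → Walk G x z (suc k)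
  here      ▷ yz = step yz here
  step xw w ▷ yz = step xw (w ▷ yz)

  reverse : ∀ {x y : V} {k} → Walk G x y k → Walk G y x k
  reverse here        = here
  reverse (step xz w) = reverse w ▷ adj-sym xz

  map : ∀ (f : V → V) → (∀ {a b} → Adj G a b → Adj G (f a) (f b)) →
        ∀ {x y k} → Walk G x y k → Walk G (f x) (f y) k
  map f f-adj here        = here
  map f f-adj (step xz w) = step (f-adj xz) (map f f-adj w)

  -- Induced walks

  record All (P : V → Set) {x y : V} {k} (w : Walk G x y k) : Set where
    constructor all
    field holds : ∀ t → t ≤ k → P (at w t)

  open All public

  module _ {P : V → Set} where

    All-++ : ∀ {x y z : V} {k l} (w : Walk G x y k) (w′ : Walk G y z l) →
             All P w → All P w′ → All P (w ++ w′)
    All-++ {k = k} {l} w w′ (all Pw) (all Pw′) = all on-++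
      where
      on-++ : ∀ t → t ≤ k + l → P (at (w ++ w′) t)
      on-++ t t≤k+l with t ≤? k
      ... | yes t≤k = subst P (sym (at-++ˡ w w′ t≤k)) (Pw t t≤k)
      ... | no  t≰k = subst P (trans (sym (at-++ʳ w w′ s)) (cong (at (w ++ w′)) k+s≡t)) (Pw′ s s≤l)
        where
        s = t ∸ k
        k+s≡t = m+[n∸m]≡n (<⇒≤ (≰⇒> t≰k))
        s≤l = +-cancelˡ-≤ k s l (subst (_≤ k + l) (sym k+s≡t) t≤k+l)

    All-map : ∀ {Q : V → Set} {x y : V} {k} {w : Walk G x y k} → (∀ {z} → Q z → P z) → All Q w → All P w
    All-map Q⇒P (all Qw) = all λ t t≤k → Q⇒P (Qw t t≤k)

    All-take : ∀ {x y : V} {k} (w : Walk G x y k) {t} (t≤k : t ≤ k) → All P w → All P (take w t t≤k)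
    All-take w t≤k (all Pw) = all λ s s≤t → subst P (sym (at-take w t≤k s≤t)) (Pw s (≤-trans s≤t t≤k))

    All-drop : ∀ {x y : V} {k} (w : Walk G x y k) {t} (t≤k : t ≤ k) → All P w → All P (drop w t t≤k)
    All-drop w {t} t≤k (all Pw) = all λ s s≤k∸t →
      subst P (sym (at-drop w t≤k s))
        (Pw (t + s) (subst (t + s ≤_) (m+[n∸m]≡n t≤k) (+-monoʳ-≤ t s≤k∸t)))

    All-≤1 : ∀ {x y : V} {k} (w : Walk G x y k) → k ≤ 1 → P x → P y → All P w
    All-≤1 here                _        Px Py = all λ _ _ → Px
    All-≤1 (step _ here)       _        Px Py = all λ { zero _ → Px ; (suc _) _ → Py }
    All-≤1 (step _ (step _ _)) (s≤s ())

  splice : ∀ {x y : V} {k l} (w : Walk G x y k) {i j} → i ≤ k → j ≤ k →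
           Walk G (at w i) (at w j) l → Walk G x y (i + (l + (k ∸ j)))
  splice w {i} {j} i≤k j≤k c = take w i i≤k ++ c ++ drop w j j≤k

  splice-shorter : ∀ {k j} i l → i + l < j → j ≤ k → i + (l + (k ∸ j)) < k
  splice-shorter {k} {j} i l i+l<j j≤k = begin-strict
    i + (l + (k ∸ j)) ≡⟨ +-assoc i l (k ∸ j) ⟨
    i + l + (k ∸ j)   <⟨ +-monoˡ-< (k ∸ j) i+l<j ⟩
    j + (k ∸ j)       ≡⟨ m+[n∸m]≡n j≤k ⟩
    k                 ∎
    where open ≤-Reasoning

  All-splice : ∀ {P : V → Set} {x y : V} {k l} (w : Walk G x y k) {i j} (i≤k : i ≤ k) (j≤k : j ≤ k)
               (c : Walk G (at w i) (at w j) l) → All P w → All P c → All P (splice w i≤k j≤k c)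
  All-splice w i≤k j≤k c Pw Pc =
    All-++ (take w _ i≤k) (c ++ drop w _ j≤k) (All-take w i≤k Pw)
      (All-++ c (drop w _ j≤k) Pc (All-drop w j≤k Pw))

  Shortcut : ∀ {x y : V} {k} → Walk G x y k → ℕ → ℕ → Set
  Shortcut w i j = at w i ≡ at w j ⊎ (suc i < j × Adj G (at w i) (at w j))

  shortcut? : ∀ {x y : V} {k} (w : Walk G x y k) i j → Dec (Shortcut w i j)
  shortcut? w i j = (at w i Fin.≟ at w j) ⊎-dec ((suc i <? j) ×-dec adj? (at w i) (at w j))

  bypass : ∀ {x y : V} {k} {w : Walk G x y k} {i j} → i < j → Shortcut w i j →
           Σ ℕ λ l → i + l < j × l ≤ 1 × Walk G (at w i) (at w j) l
  bypass {w = w} {i} {j} i<j (inj₁ wᵢ≡wⱼ) =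
    0 , subst (_< j) (sym (+-identityʳ i)) i<j , z≤n , subst (λ z → Walk G (at w i) z 0) wᵢ≡wⱼ here
  bypass {i = i} {j} i<j (inj₂ (1+i<j , wᵢwⱼ)) =
    1 , subst (_< j) (+-comm 1 i) 1+i<j , ≤-refl , step wᵢwⱼ here

  record Induced {x y : V} {k} (w : Walk G x y k) : Set where
    constructor induced
    field no-shortcut : ∀ {i j} → i < j → j ≤ k → ¬ Shortcut w i j

  open Induced public

  module _ {x y : V} {k} {w : Walk G x y k} (ind : Induced w) {i j} (i<j : i < j) (j≤k : j ≤ k) where

    induced-distinct : at w i ≢ at w j
    induced-distinct wᵢ≡wⱼ = no-shortcut ind i<j j≤k (inj₁ wᵢ≡wⱼ)

    induced-adj : Adj G (at w i) (at w j) → j ≡ suc i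
    induced-adj wᵢwⱼ =
      ≤-antisym (≮⇒≥ λ 1+i<j → no-shortcut ind i<j j≤k (inj₂ (1+i<j , wᵢwⱼ))) i<j

  induced-subwalk : ∀ {x y : V} {k} (P : V → Set) (w : Walk G x y k) → All P w →
                    Σ ℕ λ l → Σ (Walk G x y l) λ w′ → Induced w′ × All P w′
  induced-subwalk P w = go w (<-wellFounded _)
    where
    go : ∀ {x y k} (w : Walk G x y k) → Acc _<_ k → All P w →
         Σ ℕ λ l → Σ (Walk G x y l) λ w′ → Induced w′ × All P w′
    go {k = k} w (acc shorter) Pw
      with anyUpTo? (λ j → anyUpTo? (λ i → shortcut? w i j) j) (suc k)
    ... | no  none = _ , w , induced (λ i<j j≤k s → none (_ , s≤s j≤k , _ , i<j , s)) , Pw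
    ... | yes (j , s≤s j≤k , i , i<j , s) =
      let l , i+l<j , l≤1 , c = bypass {w = w} i<j s
          i≤k = ≤-trans (<⇒≤ i<j) j≤k
      in go (splice w i≤k j≤k c) (shorter (splice-shorter i l i+l<j j≤k))
            (All-splice w i≤k j≤k c Pw (All-≤1 c l≤1 (holds Pw i i≤k) (holds Pw j j≤k)))

  -- Distances and geodesics

  DistGe : V → V → ℕ → Set
  DistGe x y n = ∀ {l} → Walk G x y l → n ≤ l

  _∈N[_] : V → V → Set
  x ∈N[ y ] = x ≡ y ⊎ Adj G y x

  DistLe-trans : ∀ {x y z : V} {a b} → DistLe G x y a → DistLe G y z b → DistLe G x z (a + b)
  DistLe-trans (l , l≤a , w) (l′ , l′≤b , w′) = l + l′ , +-mono-≤ l≤a l′≤b , w ++ w′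

  DistLe-sym : ∀ {x y : V} {a} → DistLe G x y a → DistLe G y x a
  DistLe-sym (l , l≤a , w) = l , l≤a , reverse w

  DistGe-sym : ∀ {x y : V} {n} → DistGe x y n → DistGe y x n
  DistGe-sym xy w = xy (reverse w)

  DistGe-weaken : ∀ {x y : V} {m n} → m ≤ n → DistGe x y n → DistGe x y m
  DistGe-weaken m≤n xy w = ≤-trans m≤n (xy w)

  DistLe-weaken : ∀ {x y : V} {a b} → a ≤ b → DistLe G x y a → DistLe G x y b
  DistLe-weaken a≤b (l , l≤a , w) = l , ≤-trans l≤a a≤b , w

  DistGe-DistLe : ∀ {x y : V} {n a} → DistGe x y n → DistLe G x y a → n ≤ a
  DistGe-DistLe xy (l , l≤a , w) = ≤-trans (xy w) l≤a

  ∈N⇒DistLe : ∀ {x y : V} → x ∈N[ y ] → DistLe G y x 1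
  ∈N⇒DistLe (inj₁ refl) = 0 , z≤n , here
  ∈N⇒DistLe (inj₂ yx)   = 1 , ≤-refl , step yx here

  DistGe-∈N : ∀ {x y z : V} {n} → DistGe y x n → y ∈N[ z ] → DistGe z x (n ∸ 1)
  DistGe-∈N {n = n} yx y∈N[z] zx =
    m≤n+o⇒m∸n≤o n 1 (DistGe-DistLe yx (DistLe-trans (DistLe-sym (∈N⇒DistLe y∈N[z])) (_ , ≤-refl , zx)))

  at-DistLe : ∀ {x y : V} {k} (w : Walk G x y k) {i j} → i ≤ j → j ≤ k →
              DistLe G (at w i) (at w j) (j ∸ i)
  at-DistLe {k = k} w {i} {j} i≤j j≤k =
    subst (λ z → DistLe G (at w i) z (j ∸ i)) (cong (at w) i+[j∸i]≡j)
      (j ∸ i , ≤-refl , slice w i (j ∸ i) (subst (_≤ k) (sym i+[j∸i]≡j) j≤k))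
    where i+[j∸i]≡j = m+[n∸m]≡n i≤j

  geodesic-at : ∀ {x y : V} {k} → DistGe x y k → (w : Walk G x y k) → ∀ {i j} → i ≤ j → j ≤ k →
                DistGe (at w i) (at w j) (j ∸ i)
  geodesic-at {k = k} geo w {i} {j} i≤j j≤k {l} c = m≤n+o⇒m∸n≤o j i j≤i+l
    where
    rearrange : ∀ a b c → a + (b + c) ≡ c + (a + b)
    rearrange = solve-∀
    detour : k ≤ (k ∸ j) + (i + l)
    detour = subst (k ≤_) (rearrange i l (k ∸ j)) (geo (splice w (≤-trans i≤j j≤k) j≤k c))
    j≤i+l : j ≤ i + l
    j≤i+l = subst (_≤ i + l) (m∸[m∸n]≡n j≤k) (m≤n+o⇒m∸n≤o k (k ∸ j) detour)

  geodesic-induced : ∀ {x y : V} {k} → DistGe x y k → (w : Walk G x y k) → Induced w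
  geodesic-induced geo w = induced λ {i} i<j j≤k s →
    let l , i+l<j , _ , c = bypass {w = w} i<j s
    in <⇒≱ (splice-shorter i l i+l<j j≤k) (geo (splice w (≤-trans (<⇒≤ i<j) j≤k) j≤k c))

  module _ (σ : Automorphism G) where
    open Automorphism σ
    open Inverse perm

    from-adj : ∀ {a b} → Adj G a b → Adj G (from a) (from b)
    from-adj {a} {b} ab =
      trans (sym (preserve (from a) (from b)))
            (trans (cong₂ (adj G) (strictlyInverseˡ a) (strictlyInverseˡ b)) ab)

    DistGe-automorphism : ∀ {x y n} → DistGe x y n → DistGe (to x) (to y) n
    DistGe-automorphism {x} {y} xy w =
      xy (subst₂ (λ a b → Walk G a b _) (strictlyInverseʳ x) (strictlyInverseʳ y) (map from from-adj w))

  -- Induced cycles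

  CycleStep : ℕ → ℕ → ℕ → Set
  CycleStep n i j = j ≡ suc i ⊎ (i ≡ 0 × suc j ≡ n)

  record InducedClosed {x : V} {n} (c : Walk G x x n) : Set where
    field
      distinct  : ∀ {i j} → i < j → j < n → at c i ≢ at c j
      chordless : ∀ {i j} → i < j → j < n → Adj G (at c i) (at c j) → CycleStep n i j

  induced-cycle : ∀ {x : V} {n} (c : Walk G x x n) → 3 ≤ n → InducedClosed c → InducedCycle G n
  induced-cycle {x} {n} c 3≤n ind = record
    { three≤k = 3≤n
    ; c       = vertex
    ; inj     = λ {i} {j} → injective i j
    ; adjIff  = λ i j → adj⇒cycleAdj i j , cycleAdj⇒adj i j
    }
    where
    open InducedClosed ind

    vertex : Fin n → V
    vertex i = at c (toℕ i)

    injective : ∀ i j → vertex i ≡ vertex j → i ≡ j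
    injective i j cᵢ≡cⱼ with <-cmp (toℕ i) (toℕ j)
    ... | tri< i<j _ _ = contradiction cᵢ≡cⱼ (distinct i<j (Fin.toℕ<n j))
    ... | tri≈ _ i≡j _ = Fin.toℕ-injective i≡j
    ... | tri> _ _ j<i = contradiction (sym cᵢ≡cⱼ) (distinct j<i (Fin.toℕ<n i))

    adj⇒cycleSucc : ∀ i j → toℕ i < toℕ j → Adj G (vertex i) (vertex j) →
                    CycleSucc n i j ⊎ CycleSucc n j i
    adj⇒cycleSucc i j i<j cᵢcⱼ with chordless i<j (Fin.toℕ<n j) cᵢcⱼ
    ... | inj₁ j≡1+i          = inj₁ (inj₁ j≡1+i)
    ... | inj₂ (i≡0 , 1+j≡n)  = inj₂ (inj₂ (1+j≡n , i≡0))

    adj⇒cycleAdj : ∀ i j → Adj G (vertex i) (vertex j) → CycleAdj n i j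
    adj⇒cycleAdj i j cᵢcⱼ with <-cmp (toℕ i) (toℕ j)
    ... | tri< i<j _ _ = adj⇒cycleSucc i j i<j cᵢcⱼ
    ... | tri≈ _ i≡j _ = contradiction (subst (Adj G (vertex i) ∘ at c) (sym i≡j) cᵢcⱼ) adj-irrefl
    ... | tri> _ _ j<i with adj⇒cycleSucc j i j<i (adj-sym cᵢcⱼ)
    ...   | inj₁ s = inj₂ s
    ...   | inj₂ s = inj₁ s

    cycleSucc⇒adj : ∀ i j → CycleSucc n i j → Adj G (vertex i) (vertex j)
    cycleSucc⇒adj i j (inj₁ j≡1+i) =
      subst (Adj G (vertex i) ∘ at c) (sym j≡1+i) (at-adj c (Fin.toℕ<n i))
    cycleSucc⇒adj i j (inj₂ (1+i≡n , j≡0)) = subst (Adj G (vertex i)) wraps (at-adj c (Fin.toℕ<n i))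
      where
      open ≡-Reasoning
      wraps : at c (suc (toℕ i)) ≡ vertex j
      wraps = begin
        at c (suc (toℕ i)) ≡⟨ cong (at c) 1+i≡n ⟩
        at c n             ≡⟨ at-end c ⟩
        x                  ≡⟨ at-start c ⟨
        at c 0             ≡⟨ cong (at c) j≡0 ⟨
        vertex j           ∎

    cycleAdj⇒adj : ∀ i j → CycleAdj n i j → Adj G (vertex i) (vertex j)
    cycleAdj⇒adj i j (inj₁ s) = cycleSucc⇒adj i j s
    cycleAdj⇒adj i j (inj₂ s) = adj-sym (cycleSucc⇒adj j i s)

  module _ {x y : V} {k l} {p : Walk G x y k} {q : Walk G y x l}
           (p-induced : Induced p) (q-induced : Induced q)
           (separated : ∀ {s t} → 0 < s → s < l → 0 < t → t < k → ¬ at q s ∈N[ at p t ]) where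

    private
      c : Walk G x x (k + l)
      c = p ++ q

      NoChord : ℕ → ℕ → Set
      NoChord i j = at c i ≢ at c j × (Adj G (at c i) (at c j) → CycleStep (k + l) i j)

      no-chord-via : ∀ {i j a b} → at c i ≡ a → at c j ≡ b →
                     a ≢ b → (Adj G a b → CycleStep (k + l) i j) → NoChord i j
      no-chord-via refl refl a≢b adj⇒step = a≢b , adj⇒step

      c₀≡qₗ : at c 0 ≡ at q l
      c₀≡qₗ = trans (at-++ˡ p q z≤n) (trans (at-start p) (sym (at-end q)))

      cₖ≡q₀ : at c k ≡ at q 0
      cₖ≡q₀ = trans (at-++ˡ p q ≤-refl) (trans (at-end p) (sym (at-start q)))

      both-on-p : ∀ {i j} → i < j → j ≤ k → NoChord i j
      both-on-p i<j j≤k = no-chord-via (at-++ˡ p q (≤-trans (<⇒≤ i<j) j≤k)) (at-++ˡ p q j≤k)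
        (induced-distinct p-induced i<j j≤k) (inj₁ ∘ induced-adj p-induced i<j j≤k)

      both-inside-q : ∀ {s s′} → s < s′ → s′ < l → NoChord (k + s) (k + s′)
      both-inside-q {s} s<s′ s′<l = no-chord-via (at-++ʳ p q _) (at-++ʳ p q _)
        (induced-distinct q-induced s<s′ (<⇒≤ s′<l))
        (λ a → inj₁ (trans (cong (k +_) (induced-adj q-induced s<s′ (<⇒≤ s′<l) a)) (+-suc k s)))

      start-to-q : ∀ {s} → 0 < s → s < l → NoChord 0 (k + s)
      start-to-q {s} 0<s s<l = no-chord-via c₀≡qₗ (at-++ʳ p q s)
        (induced-distinct q-induced s<l ≤-refl ∘ sym)
        (λ a → inj₂ (refl , trans (sym (+-suc k s))
                              (cong (k +_) (sym (induced-adj q-induced s<l ≤-refl (adj-sym a))))))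

      end-to-q : ∀ {s} → 0 < s → s < l → NoChord k (k + s)
      end-to-q {s} 0<s s<l = no-chord-via cₖ≡q₀ (at-++ʳ p q s)
        (induced-distinct q-induced 0<s (<⇒≤ s<l))
        (λ a → inj₁ (trans (cong (k +_) (induced-adj q-induced 0<s (<⇒≤ s<l) a)) (+-comm k 1)))

      interior-to-q : ∀ {t s} → 0 < t → t < k → 0 < s → s < l → NoChord t (k + s)
      interior-to-q 0<t t<k 0<s s<l = no-chord-via (at-++ˡ p q (<⇒≤ t<k)) (at-++ʳ p q _)
        (λ pₜ≡qₛ → separated 0<s s<l 0<t t<k (inj₁ (sym pₜ≡qₛ)))
        (λ a → contradiction (inj₂ a) (separated 0<s s<l 0<t t<k))

      p-to-q : ∀ {t s} → t ≤ k → 0 < s → s < l → NoChord t (k + s)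
      p-to-q {zero}  _   = start-to-q
      p-to-q {suc t} t≤k with m≤n⇒m<n∨m≡n t≤k
      ... | inj₁ t<k  = interior-to-q (s≤s z≤n) t<k
      ... | inj₂ refl = end-to-q

      data Position (t : ℕ) : Set where
        on-p     : t ≤ k → Position t
        inside-q : ∀ s → 0 < s → s < l → t ≡ k + s → Position t

      position : ∀ t → t < k + l → Position t
      position t t<k+l with t ≤? k
      ... | yes t≤k = on-p t≤k
      ... | no  t≰k = inside-q (t ∸ k) (m<n⇒0<n∸m k<t) t∸k<l (sym (m+[n∸m]≡n (<⇒≤ k<t)))
        where
        k<t = ≰⇒> t≰k
        t∸k<l = subst (t ∸ k <_) (m+n∸m≡n k l) (∸-monoˡ-< t<k+l (<⇒≤ k<t))

      no-chord : ∀ {i j} → i < j → j < k + l → NoChord i j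
      no-chord {i} {j} i<j j<k+l with position j j<k+l | position i (<-trans i<j j<k+l)
      ... | on-p j≤k                   | _                   = both-on-p i<j j≤k
      ... | inside-q s′ 0<s′ s′<l refl | on-p i≤k            = p-to-q i≤k 0<s′ s′<l
      ... | inside-q s′ _    s′<l refl | inside-q s _ _ refl = both-inside-q (+-cancelˡ-< k s s′ i<j) s′<l

    glue-induced : InducedClosed (p ++ q)
    glue-induced = record
      { distinct  = λ i<j j<n → proj₁ (no-chord i<j j<n)
      ; chordless = λ i<j j<n → proj₂ (no-chord i<j j<n)
      }

  -- Balls around the middle of a geodesic

  geodesic-apart : ∀ {x y : V} {k} → DistGe x y k → (w : Walk G x y k) →
                   ∀ {i j r} → i + r < j → j ≤ k → ¬ DistLe G (at w i) (at w j) r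
  geodesic-apart geo w {i} {j} {r} i+r<j j≤k wᵢwⱼ =
    <⇒≱ (m+n≤o⇒m≤o∸n (suc r) (subst (_≤ j) (cong suc (+-comm i r)) i+r<j))
        (DistGe-DistLe (geodesic-at geo w (≤-trans (m≤m+n i r) (<⇒≤ i+r<j)) j≤k) wᵢwⱼ)

  near-midpoint : ∀ {x y z : V} {r t} (w : Walk G x y (r + r)) → 0 < t → t < r + r → z ∈N[ at w t ] →
                  DistLe G (at w r) z r
  near-midpoint {r = r} {t} w 0<t t<r+r z∈N =
    let e , e<r , wᵣwₜ = toward
    in DistLe-weaken (subst (_≤ r) (+-comm 1 e) e<r) (DistLe-trans wᵣwₜ (∈N⇒DistLe z∈N))
    where
    toward : Σ ℕ λ e → e < r × DistLe G (at w r) (at w t) e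
    toward with t ≤? r
    ... | yes t≤r = r ∸ t , ∸-monoʳ-< 0<t t≤r , DistLe-sym (at-DistLe w t≤r (m≤m+n r r))
    ... | no  t≰r = t ∸ r , t∸r<r , at-DistLe w r≤t (<⇒≤ t<r+r)
      where
      r≤t = <⇒≤ (≰⇒> t≰r)
      t∸r<r = subst (t ∸ r <_) (m+n∸m≡n r r) (∸-monoˡ-< t<r+r r≤t)

  ball-avoiding : ∀ {x y z : V} {k α β} r → DistGe z x α → DistGe z y β → (w : Walk G x y k) →
                  k + (r + r) < α + β → All (λ v → ¬ DistLe G z v r) w
  ball-avoiding {k = k} {α} {β} r zx zy w short = all λ t t≤k zwₜ → <⇒≱ short (begin
    α + β                     ≤⟨ +-mono-≤ (via-start zwₜ t≤k) (via-end zwₜ t≤k) ⟩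
    (r + t) + (r + (k ∸ t))   ≡⟨ rearrange r t (k ∸ t) ⟩
    (t + (k ∸ t)) + (r + r)   ≡⟨ cong (_+ (r + r)) (m+[n∸m]≡n t≤k) ⟩
    k + (r + r)               ∎)
    where
    open ≤-Reasoning
    rearrange : ∀ a b c → (a + b) + (a + c) ≡ (b + c) + (a + a)
    rearrange = solve-∀
    via-start : ∀ {t} → DistLe G _ (at w t) r → (t≤k : t ≤ k) → α ≤ r + t
    via-start zwₜ t≤k = DistGe-DistLe zx (DistLe-trans zwₜ (DistLe-sym (_ , ≤-refl , take w _ t≤k)))
    via-end : ∀ {t} → DistLe G _ (at w t) r → (t≤k : t ≤ k) → β ≤ r + (k ∸ t)
    via-end zwₜ t≤k = DistGe-DistLe zy (DistLe-trans zwₜ (_ , ≤-refl , drop w _ t≤k))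

  diameter-geodesic : ∀ {d} → IsDiameter G d → Σ V λ u → Σ V λ v → Walk G u v d × DistGe u v d
  diameter-geodesic {d} (bounded , u , v , no-shorter) =
    let l , l≤d , w = bounded u v
    in u , v , subst (Walk G u v) (≤-antisym l≤d (geodesic w)) w , geodesic
    where
    geodesic : DistGe u v d
    geodesic w = ≮⇒≥ λ l<d → no-shorter _ l<d w

  module _ (nt : NearlyTransitive G) {d} (bounded : ∀ x y → DistLe G x y d)
           {u v : V} (P : Walk G u v d) (P-geodesic : DistGe u v d)
           (r : ℕ) (1≤r : 1 ≤ r) (room : (2 + r + r) + (2 + r + r) ≤ d) where

    private
      ia im ib : ℕ
      ia = 2 + r
      im = ia + r
      ib = ia + (r + r)

      im≤d : im ≤ d
      im≤d = ≤-trans (m≤m+n im im) room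

      ib≤d : ib ≤ d
      ib≤d = ≤-trans (subst (ib ≤_) (sym (+-assoc ia r im)) (+-monoʳ-≤ ia (+-monoʳ-≤ r (m≤n+m r ia)))) room

      ia≤d : ia ≤ d
      ia≤d = ≤-trans (m≤m+n ia (r + r)) ib≤d

      a m b : V
      a = at P ia
      m = at P im
      b = at P ib

      Ball : V → Set
      Ball z = DistLe G m z r

      -- a and b lie at distance exactly r from m.
      Admissible : V → Set
      Admissible z = z ≡ a ⊎ z ≡ b ⊎ ¬ Ball z

      σ : Automorphism G
      σ = proj₁ (nt m v)

      w₀ : V
      w₀ = Inverse.to (Automorphism.perm σ) u

      m-w₀ : DistGe m w₀ (d ∸ 1)
      m-w₀ = DistGe-∈N (DistGe-automorphism σ (DistGe-sym P-geodesic)) (proj₂ (nt m v))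

      m-u : DistGe m u im
      m-u = DistGe-sym (subst (λ z → DistGe z m im) (at-start P) (geodesic-at P-geodesic P z≤n im≤d))

      m-v : DistGe m v im
      m-v = DistGe-weaken (m+n≤o⇒m≤o∸n im room)
        (subst (λ z → DistGe m z (d ∸ im)) (at-end P) (geodesic-at P-geodesic P im≤d ≤-refl))

      detour-room : ∀ {l} → l ≤ d → l + (r + r) < (d ∸ 1) + im
      detour-room {l} l≤d = begin-strict
        l + (r + r)                 <⟨ s≤s (+-monoˡ-≤ (r + r) (≤-trans l≤d (m≤n+m∸n d 1))) ⟩
        suc (suc (d ∸ 1) + (r + r)) ≡⟨ shift (d ∸ 1) r ⟩
        (d ∸ 1) + im                ∎
        where
        open ≤-Reasoning
        shift : ∀ e r → suc (suc e + (r + r)) ≡ e + (2 + r + r)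
        shift = solve-∀

      prefix-admissible : All Admissible (take P ia ia≤d)
      prefix-admissible = all λ t t≤ia → subst Admissible (sym (at-take P ia≤d t≤ia)) (on t t≤ia)
        where
        on : ∀ t → t ≤ ia → Admissible (at P t)
        on t t≤ia with m≤n⇒m<n∨m≡n t≤ia
        ... | inj₁ t<ia = inj₂ (inj₂ (geodesic-apart P-geodesic P (+-monoˡ-< r t<ia) im≤d ∘ DistLe-sym))
        ... | inj₂ refl = inj₁ refl

      suffix-admissible : All Admissible (drop P ib ib≤d)
      suffix-admissible = all λ s s≤ → subst Admissible (sym (at-drop P ib≤d s)) (on s s≤)
        where
        on : ∀ s → s ≤ d ∸ ib → Admissible (at P (ib + s))
        on zero    _ = inj₂ (inj₁ (cong (at P) (+-identityʳ ib)))
        on (suc s) s≤ = inj₂ (inj₂ (geodesic-apart P-geodesic P im+r<ib+s ib+s≤d))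
          where
          im+r<ib+s : im + r < ib + suc s
          im+r<ib+s = subst (_< ib + suc s) (sym (+-assoc ia r r)) (m<m+n ib (s≤s z≤n))
          ib+s≤d : ib + suc s ≤ d
          ib+s≤d = subst (ib + suc s ≤_) (m+[n∸m]≡n ib≤d) (+-monoʳ-≤ ib s≤)

      l₁ l₂ : ℕ
      l₁ = proj₁ (bounded w₀ u)
      l₂ = proj₁ (bounded v w₀)

      R₁ : Walk G w₀ u l₁
      R₁ = proj₂ (proj₂ (bounded w₀ u))

      R₂ : Walk G v w₀ l₂
      R₂ = proj₂ (proj₂ (bounded v w₀))

      R₁-outside : All (¬_ ∘ Ball) R₁
      R₁-outside = ball-avoiding r m-w₀ m-u R₁ (detour-room (proj₁ (proj₂ (bounded w₀ u))))

      R₂-outside : All (¬_ ∘ Ball) R₂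
      R₂-outside = ball-avoiding r m-v m-w₀ R₂
        (subst (l₂ + (r + r) <_) (+-comm (d ∸ 1) im) (detour-room (proj₁ (proj₂ (bounded v w₀)))))

      detour : Walk G b a _
      detour = drop P ib ib≤d ++ R₂ ++ R₁ ++ take P ia ia≤d

      detour-admissible : All Admissible detour
      detour-admissible =
        All-++ (drop P ib ib≤d) (R₂ ++ R₁ ++ take P ia ia≤d) suffix-admissible
          (All-++ R₂ (R₁ ++ take P ia ia≤d) (All-map (inj₂ ∘ inj₂) R₂-outside)
            (All-++ R₁ (take P ia ia≤d) (All-map (inj₂ ∘ inj₂) R₁-outside) prefix-admissible))

      -- Opaque, so that type checking never unfolds the shortcut search.
      opaque
        reduced : Σ ℕ λ l → Σ (Walk G b a l) λ w → Induced w × All Admissible w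
        reduced = induced-subwalk Admissible detour detour-admissible

      s : ℕ
      s = proj₁ reduced
      S : Walk G b a s
      S = proj₁ (proj₂ reduced)
      S-induced : Induced S
      S-induced = proj₁ (proj₂ (proj₂ reduced))
      S-admissible : All Admissible S
      S-admissible = proj₂ (proj₂ (proj₂ reduced))

      S-interior-outside : ∀ {t} → 0 < t → t < s → ¬ Ball (at S t)
      S-interior-outside {t} 0<t t<s with holds S-admissible t (<⇒≤ t<s)
      ... | inj₁ Sₜ≡a         = contradiction (trans Sₜ≡a (sym (at-end S))) (induced-distinct S-induced t<s ≤-refl)
      ... | inj₂ (inj₁ Sₜ≡b)  = contradiction (trans (at-start S) (sym Sₜ≡b)) (induced-distinct S-induced 0<t (<⇒≤ t<s))
      ... | inj₂ (inj₂ ¬ball) = ¬ball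

      P[a,b] : Walk G a b (r + r)
      P[a,b] = slice P ia (r + r) ib≤d

      a-b : DistGe a b (r + r)
      a-b = subst (DistGe a b) (m+n∸m≡n ia (r + r)) (geodesic-at P-geodesic P (m≤m+n ia (r + r)) ib≤d)

      r+r≤s : r + r ≤ s
      r+r≤s = DistGe-sym a-b S

      midpoint : at P[a,b] r ≡ m
      midpoint = at-slice P ia ib≤d (m≤m+n r r)

      separated : ∀ {s′ t} → 0 < s′ → s′ < s → 0 < t → t < r + r → ¬ at S s′ ∈N[ at P[a,b] t ]
      separated 0<s′ s′<s 0<t t<r+r Sₛ∈N = S-interior-outside 0<s′ s′<s
        (subst (λ z → DistLe G z (at S _) r) midpoint (near-midpoint P[a,b] 0<t t<r+r Sₛ∈N))

      3≤length : 3 ≤ (r + r) + s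
      3≤length = +-mono-≤ (+-mono-≤ 1≤r 1≤r) (≤-trans 1≤r (≤-trans (m≤m+n r r) r+r≤s))

    long-induced-cycle : Σ ℕ λ k → (r + r) + (r + r) ≤ k × InducedCycle G k
    long-induced-cycle =
      (r + r) + s , +-monoʳ-≤ (r + r) r+r≤s ,
      induced-cycle (P[a,b] ++ S) 3≤length
        (glue-induced (geodesic-induced a-b P[a,b]) S-induced separated)

radius : ∀ {d} → 20 ≤ d →
         Σ ℕ λ r → 1 ≤ r × (2 + r + r) + (2 + r + r) ≤ d × d ∸ 17 ≤ (r + r) + (r + r)
radius {d} 20≤d = r , m≥n⇒m/n>0 (m+n≤o⇒m≤o∸n 4 (≤-trans (m≤m+n 8 12) 20≤d)) , room , bound
  where
  r = (d ∸ 4) / 4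
  ρ = (d ∸ 4) % 4
  d≡4+ρ+4r : d ≡ 4 + (ρ + r * 4)
  d≡4+ρ+4r = trans (sym (m+[n∸m]≡n (≤-trans (m≤m+n 4 16) 20≤d))) (cong (4 +_) (m≡m%n+[m/n]*n (d ∸ 4) 4))
  times-4 : ∀ r → r * 4 ≡ (r + r) + (r + r)
  times-4 = solve-∀
  4+4r : ∀ r → 4 + (r + r) + (r + r) ≡ (2 + r + r) + (2 + r + r)
  4+4r = solve-∀
  room : (2 + r + r) + (2 + r + r) ≤ d
  room = subst₂ _≤_ (trans (cong (4 +_) (times-4 r)) (4+4r r)) (sym d≡4+ρ+4r)
           (+-monoʳ-≤ 4 (m≤n+m (r * 4) ρ))
  bound : d ∸ 17 ≤ (r + r) + (r + r)
  bound = m≤n+o⇒m∸n≤o d 17 (subst₂ _≤_ (sym d≡4+ρ+4r) (cong (17 +_) (times-4 r))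
    (+-monoʳ-≤ 4 (+-monoˡ-≤ (r * 4) (≤-trans (<⇒≤ (m%n<n (d ∸ 4) 4)) (m≤m+n 4 9)))))

lemma2p11 : (G : Graph) → Connected G → NearlyTransitive G →
    (d : ℕ) → IsDiameter G d → 20 ≤ d →
    Σ ℕ λ k → (d ∸ 17 ≤ k) × InducedCycle G k
lemma2p11 G _ nt d diameter 20≤d =
  let u , v , P , P-geodesic = diameter-geodesic diameter
      r , 1≤r , room , d∸17≤4r = radius 20≤d
      k , 4r≤k , cycle = long-induced-cycle nt (proj₁ diameter) P P-geodesic r 1≤r room
  in k , ≤-trans d∸17≤4r 4r≤k , cycle
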